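{- Let $f=(f_1,f_2,\dots)$ be a sequence of nonzero integers with $f_1=1$. For integers $j\ge0$ let $C_j=(C_j(N))_{N\ge1}$ with $C_j(N)=\left[{N+j-1\atop j}\right]_f$, and for integers $m\ge0$ let $R_m=(R_m(1),\dots,R_m(m+1))$ with $R_m(N)=\left[{m\atop N-1}\right]_f$. Then every column sequence $C_j$ ($j\ge0$) is binomid if and only if every row sequence $R_m$ ($m\ge0$) is binomid. In particular these conditions hold when $f$ is binomid at every level.
   Context: For a (finite or infinite) sequence $h=(h_1,h_2,\dots)$ of nonzero rational numbers and integers $0\le k\le n$ (with $n$ at most the length of $h$), $\left[{n\atop k}\right]_h=\dfrac{h_nh_{n-1}\cdots h_{n-k+1}}{h_kh_{k-1}\cdots h_1}$ (equal to $1$ for $k=0$). $h$ is binomid if all these coefficients are integers. $f$ is binomid at every level if every column sequence $C_j$ is binomid. -}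

module Defs where

open import Data.Nat using (ℕ; zero; suc; _∸_; _+_; _≤_)
open import Data.Integer using (ℤ)
open import Data.Rational using (ℚ; 0ℚ; 1ℚ; _*_; _÷_; ≢-nonZero)
import Data.Rational as ℚ
open import Data.Rational.Properties using (_≟_)
open import Data.Product using (∃)
open import Relation.Binary.PropositionalEquality using (_≡_)
open import Relation.Nullary using (yes; no)

-- A sequence h = (h_1, h_2, ...) of rationals is encoded as a function
-- ℕ → ℚ; the value at index 0 is never used.

numer : (ℕ → ℚ) → ℕ → ℕ → ℚ
numer h n zero    = 1ℚ
numer h n (suc k) = h n * numer h (n ∸ 1) k

denom : (ℕ → ℚ) → ℕ → ℚ
denom h zero    = 1ℚ
denom h (suc k) = h (suc k) * denom h k

-- generalized binomial coefficient [n k]_h = numer / denom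
-- (the denominator is nonzero for sequences of nonzero terms; the
--  zero-denominator branch is a junk value that never occurs then)
gbinom : (ℕ → ℚ) → ℕ → ℕ → ℚ
gbinom h n k with denom h k ≟ 0ℚ
... | yes _  = 0ℚ
... | no d≢0 = _÷_ (numer h n k) (denom h k) {{≢-nonZero d≢0}}

IsInteger : ℚ → Set
IsInteger q = ∃ λ (z : ℤ) → q ≡ z ℚ./ 1

Binomid : (ℕ → ℚ) → Set
Binomid h = ∀ n k → k ≤ n → IsInteger (gbinom h n k)

BinomidFin : ℕ → (ℕ → ℚ) → Set
BinomidFin L h = ∀ n k → k ≤ n → n ≤ L → IsInteger (gbinom h n k)

toℚ : (ℕ → ℤ) → ℕ → ℚ
toℚ f i = f i ℚ./ 1

Col : (ℕ → ℤ) → ℕ → ℕ → ℚ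
Col f j N = gbinom (toℚ f) (N + j ∸ 1) j

-- row sequence R_m(N) = [m, N-1]_f   (1 ≤ N ≤ m+1), length m+1
Row : (ℕ → ℤ) → ℕ → ℕ → ℚ
Row f m N = gbinom (toℚ f) m (N ∸ 1)

BinomidAtEveryLevel : (ℕ → ℤ) → Set
BinomidAtEveryLevel f = ∀ j → Binomid (Col f j)

-- Write D_k = f_k ⋯ f_1 and m = n-1+j. For 1 ≤ N ≤ n,
--   C_j(N) · D_j D_m = R_m(N) · u(N),   u(N) = D_{N+j-1} D_{m-N+1},
-- and u is a palindrome on [1, n]: u(n+1-N) = u(N). For a palindrome the numerator and
-- denominator of [n k]_u are the same product, so [n k]_u = 1, as for a constant sequence.
-- Since [n k]_h is multiplicative in h, this gives [n k]_{C_j} = [n k]_{R_m} for all k ≤ n,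
-- so the column and row conditions are the same family of conditions.
module Submission where

open import Defs
open import Data.Nat using (ℕ; _≤_)
open import Data.Integer using (ℤ; +_)
open import Data.Product using (_×_)
open import Function.Bundles using (_⇔_)
open import Relation.Binary.PropositionalEquality using (_≡_; _≢_)

open import Data.Nat using (zero; suc; _∸_; _+_; _<_; z≤n; s≤s)
import Data.Nat.Properties as ℕ
import Data.Integer as ℤ
import Data.Integer.Properties as ℤ
open import Data.Integer.GCD using (gcd)
open import Data.Rational using (ℚ; 0ℚ; 1ℚ; _*_; _÷_; 1/_; ≢-nonZero; ↥_)
import Data.Rational as ℚ
open import Data.Rational.Properties
  using (*-assoc; *-comm; *-identityˡ; *-identityʳ; *-zeroˡ; *-inverseˡ; *-inverseʳ; ↥-/; _≟_; *-1-commutativeMonoid)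
open import Algebra.Bundles using (CommutativeMonoid)
open import Algebra.Properties.CommutativeSemigroup
  (CommutativeMonoid.commutativeSemigroup *-1-commutativeMonoid)
  renaming (interchange to *-interchange)
  using ()
open import Data.Rational.Solver using (module +-*-Solver)
open +-*-Solver using (solve; _:*_; _:=_)
open import Data.Product using (_,_)
open import Data.Empty using (⊥-elim)
open import Relation.Nullary using (yes; no)
open import Relation.Binary.PropositionalEquality
  using (refl; sym; trans; cong; cong₂; subst; module ≡-Reasoning)
open import Function.Bundles using (mk⇔)
open ≡-Reasoning

*-cancelʳ-≡ : ∀ {x y c : ℚ} → c ≢ 0ℚ → x * c ≡ y * c → x ≡ y
*-cancelʳ-≡ {x} {y} {c} c≢0 eq = begin
    x                  ≡⟨ sym (*-identityʳ x) ⟩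
    x * 1ℚ             ≡⟨ cong (x *_) (sym (*-inverseʳ c)) ⟩
    x * (c * (1/ c))   ≡⟨ sym (*-assoc x c (1/ c)) ⟩
    x * c * (1/ c)     ≡⟨ cong (_* (1/ c)) eq ⟩
    y * c * (1/ c)     ≡⟨ *-assoc y c (1/ c) ⟩
    y * (c * (1/ c))   ≡⟨ cong (y *_) (*-inverseʳ c) ⟩
    y * 1ℚ             ≡⟨ *-identityʳ y ⟩
    y                  ∎
  where instance _ = ≢-nonZero c≢0

*-≢0 : ∀ {x y : ℚ} → x ≢ 0ℚ → y ≢ 0ℚ → x * y ≢ 0ℚ
*-≢0 {x} {y} x≢0 y≢0 xy≡0 = x≢0 (*-cancelʳ-≡ y≢0 (trans xy≡0 (sym (*-zeroˡ y))))

÷-*-cancel : ∀ p q (q≢0 : q ≢ 0ℚ) → _÷_ p q {{≢-nonZero q≢0}} * q ≡ p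
÷-*-cancel p q q≢0 = begin
    p * (1/ q) * q     ≡⟨ *-assoc p (1/ q) q ⟩
    p * ((1/ q) * q)   ≡⟨ cong (p *_) (*-inverseˡ q) ⟩
    p * 1ℚ             ≡⟨ *-identityʳ p ⟩
    p                  ∎
  where instance _ = ≢-nonZero q≢0

NonZeroOn : ℕ → (ℕ → ℚ) → Set
NonZeroOn n h = ∀ N → 1 ≤ N → N ≤ n → h N ≢ 0ℚ

denom≢0 : ∀ {h n} k → NonZeroOn n h → k ≤ n → denom h k ≢ 0ℚ
denom≢0 zero    _  _    ()
denom≢0 (suc k) nz k<n = *-≢0 (nz (suc k) (s≤s z≤n) k<n) (denom≢0 k nz (ℕ.<⇒≤ k<n))

gbinom*denom≡numer : ∀ h n k → denom h k ≢ 0ℚ → gbinom h n k * denom h k ≡ numer h n k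
gbinom*denom≡numer h n k d≢0 with denom h k ≟ 0ℚ
... | yes d≡0 = ⊥-elim (d≢0 d≡0)
... | no d≢0′ = ÷-*-cancel (numer h n k) (denom h k) d≢0′

isInteger-gbinom-zero : ∀ h n → IsInteger (gbinom h n 0)
isInteger-gbinom-zero h n = + 1 , trans (sym (*-identityʳ (gbinom h n 0))) (gbinom*denom≡numer h n 0 (λ ()))

numer-last : ∀ h n k → numer h n (suc k) ≡ numer h n k * h (n ∸ k)
numer-last h n zero = trans (*-identityʳ (h n)) (sym (*-identityˡ (h n)))
numer-last h n (suc k) = begin
    h n * numer h (n ∸ 1) (suc k)                ≡⟨ cong (h n *_) (numer-last h (n ∸ 1) k) ⟩
    h n * (numer h (n ∸ 1) k * h (n ∸ 1 ∸ k))    ≡⟨ sym (*-assoc (h n) _ _) ⟩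
    h n * numer h (n ∸ 1) k * h (n ∸ 1 ∸ k)      ≡⟨ cong (λ i → h n * numer h (n ∸ 1) k * h i) (ℕ.∸-+-assoc n 1 k) ⟩
    h n * numer h (n ∸ 1) k * h (n ∸ suc k)      ∎

numer*denom≡denom : ∀ h a b → b ≤ a → numer h a b * denom h (a ∸ b) ≡ denom h a
numer*denom≡denom h a zero _ = *-identityˡ (denom h a)
numer*denom≡denom h (suc a) (suc b) (s≤s b≤a) = begin
    h (suc a) * numer h a b * denom h (a ∸ b)     ≡⟨ *-assoc (h (suc a)) (numer h a b) (denom h (a ∸ b)) ⟩
    h (suc a) * (numer h a b * denom h (a ∸ b))   ≡⟨ cong (h (suc a) *_) (numer*denom≡denom h a b b≤a) ⟩
    h (suc a) * denom h a                         ∎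

gbinom*denom*denom≡denom : ∀ h a b → b ≤ a → denom h b ≢ 0ℚ →
                           gbinom h a b * (denom h b * denom h (a ∸ b)) ≡ denom h a
gbinom*denom*denom≡denom h a b b≤a d≢0 = begin
    gbinom h a b * (denom h b * denom h (a ∸ b))   ≡⟨ sym (*-assoc (gbinom h a b) (denom h b) (denom h (a ∸ b))) ⟩
    gbinom h a b * denom h b * denom h (a ∸ b)     ≡⟨ cong (_* denom h (a ∸ b)) (gbinom*denom≡numer h a b d≢0) ⟩
    numer h a b * denom h (a ∸ b)                  ≡⟨ numer*denom≡denom h a b b≤a ⟩
    denom h a                                      ∎

gbinom-≢0 : ∀ {h a} b → NonZeroOn a h → b ≤ a → gbinom h a b ≢ 0ℚ
gbinom-≢0 {h} {a} b nz b≤a x≡0 = denom≢0 a nz ℕ.≤-refl (begin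
    denom h a                                      ≡⟨ sym (gbinom*denom*denom≡denom h a b b≤a (denom≢0 b nz b≤a)) ⟩
    gbinom h a b * (denom h b * denom h (a ∸ b))   ≡⟨ cong (_* (denom h b * denom h (a ∸ b))) x≡0 ⟩
    0ℚ * (denom h b * denom h (a ∸ b))             ≡⟨ *-zeroˡ (denom h b * denom h (a ∸ b)) ⟩
    0ℚ                                             ∎)

numer-cong : ∀ {h g} n k → (∀ N → 1 ≤ N → N ≤ n → h N ≡ g N) → k ≤ n → numer h n k ≡ numer g n k
numer-cong n zero _ _ = refl
numer-cong (suc n) (suc k) h≡g (s≤s k≤n) = cong₂ _*_ (h≡g (suc n) (s≤s z≤n) ℕ.≤-refl)
  (numer-cong n k (λ N 1≤N N≤n → h≡g N 1≤N (ℕ.m≤n⇒m≤1+n N≤n)) k≤n)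

denom-cong : ∀ {h g} k → (∀ N → 1 ≤ N → N ≤ k → h N ≡ g N) → denom h k ≡ denom g k
denom-cong zero _ = refl
denom-cong (suc k) h≡g = cong₂ _*_ (h≡g (suc k) (s≤s z≤n) ℕ.≤-refl)
  (denom-cong k (λ N 1≤N N≤k → h≡g N 1≤N (ℕ.m≤n⇒m≤1+n N≤k)))

_⊙_ : (ℕ → ℚ) → (ℕ → ℚ) → ℕ → ℚ
(h ⊙ g) N = h N * g N

NonZeroOn-⊙ : ∀ {h g n} → NonZeroOn n h → NonZeroOn n g → NonZeroOn n (h ⊙ g)
NonZeroOn-⊙ nzₕ nz₉ N 1≤N N≤n = *-≢0 (nzₕ N 1≤N N≤n) (nz₉ N 1≤N N≤n)

numer-⊙ : ∀ h g n k → numer (h ⊙ g) n k ≡ numer h n k * numer g n k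
numer-⊙ h g n zero = sym (*-identityˡ 1ℚ)
numer-⊙ h g n (suc k) = trans (cong (h n * g n *_) (numer-⊙ h g (n ∸ 1) k))
  (*-interchange (h n) (g n) (numer h (n ∸ 1) k) (numer g (n ∸ 1) k))

denom-⊙ : ∀ h g k → denom (h ⊙ g) k ≡ denom h k * denom g k
denom-⊙ h g zero = sym (*-identityˡ 1ℚ)
denom-⊙ h g (suc k) = trans (cong (h (suc k) * g (suc k) *_) (denom-⊙ h g k))
  (*-interchange (h (suc k)) (g (suc k)) (denom h k) (denom g k))

gbinom-cong : ∀ {h g} n k → (∀ N → 1 ≤ N → N ≤ n → h N ≡ g N) → k ≤ n → denom h k ≢ 0ℚ →
              gbinom h n k ≡ gbinom g n k
gbinom-cong {h} {g} n k h≡g k≤n dₕ≢0 = *-cancelʳ-≡ dₕ≢0 (begin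
    gbinom h n k * denom h k   ≡⟨ gbinom*denom≡numer h n k dₕ≢0 ⟩
    numer h n k                ≡⟨ numer-cong n k h≡g k≤n ⟩
    numer g n k                ≡⟨ sym (gbinom*denom≡numer g n k d₉≢0) ⟩
    gbinom g n k * denom g k   ≡⟨ cong (gbinom g n k *_) (sym dₕ≡d₉) ⟩
    gbinom g n k * denom h k   ∎)
  where
  dₕ≡d₉ : denom h k ≡ denom g k
  dₕ≡d₉ = denom-cong k (λ N 1≤N N≤k → h≡g N 1≤N (ℕ.≤-trans N≤k k≤n))
  d₉≢0 : denom g k ≢ 0ℚ
  d₉≢0 = subst (_≢ 0ℚ) dₕ≡d₉ dₕ≢0

gbinom-⊙ : ∀ h g n k → denom h k ≢ 0ℚ → denom g k ≢ 0ℚ →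
           gbinom (h ⊙ g) n k ≡ gbinom h n k * gbinom g n k
gbinom-⊙ h g n k dₕ≢0 d₉≢0 = *-cancelʳ-≡ dₕd₉≢0 (begin
    gbinom (h ⊙ g) n k * (dₕ * d₉)      ≡⟨ cong (gbinom (h ⊙ g) n k *_) (sym (denom-⊙ h g k)) ⟩
    gbinom (h ⊙ g) n k * denom (h ⊙ g) k
      ≡⟨ gbinom*denom≡numer (h ⊙ g) n k (subst (_≢ 0ℚ) (sym (denom-⊙ h g k)) dₕd₉≢0) ⟩
    numer (h ⊙ g) n k                   ≡⟨ numer-⊙ h g n k ⟩
    numer h n k * numer g n k
      ≡⟨ sym (cong₂ _*_ (gbinom*denom≡numer h n k dₕ≢0) (gbinom*denom≡numer g n k d₉≢0)) ⟩
    (bₕ * dₕ) * (b₉ * d₉)               ≡⟨ *-interchange bₕ dₕ b₉ d₉ ⟩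
    (bₕ * b₉) * (dₕ * d₉)               ∎)
  where
  bₕ = gbinom h n k
  b₉ = gbinom g n k
  dₕ = denom h k
  d₉ = denom g k
  dₕd₉≢0 : dₕ * d₉ ≢ 0ℚ
  dₕd₉≢0 = *-≢0 dₕ≢0 d₉≢0

Palindrome : ℕ → (ℕ → ℚ) → Set
Palindrome n u = ∀ i → i < n → u (n ∸ i) ≡ u (suc i)

numer≡denom : ∀ {u n} → Palindrome n u → ∀ k → k ≤ n → numer u n k ≡ denom u k
numer≡denom _ zero _ = refl
numer≡denom {u} {n} pal (suc k) k<n = begin
    numer u n (suc k)         ≡⟨ numer-last u n k ⟩
    numer u n k * u (n ∸ k)   ≡⟨ cong₂ _*_ (numer≡denom pal k (ℕ.<⇒≤ k<n)) (pal k k<n) ⟩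
    denom u k * u (suc k)     ≡⟨ *-comm (denom u k) (u (suc k)) ⟩
    u (suc k) * denom u k     ∎

gbinom-palindrome : ∀ {u n} k → Palindrome n u → k ≤ n → denom u k ≢ 0ℚ → gbinom u n k ≡ 1ℚ
gbinom-palindrome {u} {n} k pal k≤n d≢0 = *-cancelʳ-≡ d≢0 (begin
    gbinom u n k * denom u k   ≡⟨ gbinom*denom≡numer u n k d≢0 ⟩
    numer u n k                ≡⟨ numer≡denom pal k k≤n ⟩
    denom u k                  ≡⟨ sym (*-identityˡ (denom u k)) ⟩
    1ℚ * denom u k             ∎)

gbinom-palindromic-rescaling :
  ∀ {h g u v n} k → k ≤ n → Palindrome n u → Palindrome n v →
  NonZeroOn n h → NonZeroOn n g → NonZeroOn n u → NonZeroOn n v →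
  (∀ N → 1 ≤ N → N ≤ n → h N * v N ≡ g N * u N) → gbinom h n k ≡ gbinom g n k
gbinom-palindromic-rescaling {h} {g} {u} {v} {n} k k≤n palᵤ palᵥ nzₕ nz₉ nzᵤ nzᵥ hv≡gu = begin
    gbinom h n k                  ≡⟨ sym (*-identityʳ (gbinom h n k)) ⟩
    gbinom h n k * 1ℚ             ≡⟨ cong (gbinom h n k *_) (sym (gbinom-palindrome k palᵥ k≤n (d≢0 nzᵥ))) ⟩
    gbinom h n k * gbinom v n k   ≡⟨ sym (gbinom-⊙ h v n k (d≢0 nzₕ) (d≢0 nzᵥ)) ⟩
    gbinom (h ⊙ v) n k            ≡⟨ gbinom-cong n k hv≡gu k≤n (d≢0 (NonZeroOn-⊙ nzₕ nzᵥ)) ⟩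
    gbinom (g ⊙ u) n k            ≡⟨ gbinom-⊙ g u n k (d≢0 nz₉) (d≢0 nzᵤ) ⟩
    gbinom g n k * gbinom u n k   ≡⟨ cong (gbinom g n k *_) (gbinom-palindrome k palᵤ k≤n (d≢0 nzᵤ)) ⟩
    gbinom g n k * 1ℚ             ≡⟨ *-identityʳ (gbinom g n k) ⟩
    gbinom g n k                  ∎
  where
  d≢0 : ∀ {w} → NonZeroOn n w → denom w k ≢ 0ℚ
  d≢0 nz = denom≢0 k nz k≤n

module _ (f : ℕ → ℤ) (f≢0 : ∀ i → 1 ≤ i → f i ≢ + 0) where

  private
    D : ℕ → ℚ
    D = denom (toℚ f)

  toℚ≢0 : ∀ {n} → NonZeroOn n (toℚ f)
  toℚ≢0 i 1≤i _ fᵢ≡0 = f≢0 i 1≤i (begin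
      f i                                   ≡⟨ sym (↥-/ (f i) 1) ⟩
      ↥ (f i ℚ./ 1) ℤ.* gcd (f i) (+ 1)     ≡⟨ cong (λ q → ↥ q ℤ.* gcd (f i) (+ 1)) fᵢ≡0 ⟩
      + 0 ℤ.* gcd (f i) (+ 1)               ≡⟨ ℤ.*-zeroˡ (gcd (f i) (+ 1)) ⟩
      + 0                                   ∎)

  D≢0 : ∀ k → D k ≢ 0ℚ
  D≢0 k = denom≢0 k toℚ≢0 ℕ.≤-refl

  gbinom*D*D≡D : ∀ a b → b ≤ a → gbinom (toℚ f) a b * (D b * D (a ∸ b)) ≡ D a
  gbinom*D*D≡D a b b≤a = gbinom*denom*denom≡denom (toℚ f) a b b≤a (D≢0 b)

  Col*D*D≡Row*D*D : ∀ j m N′ → N′ ≤ m →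
    Col f j (suc N′) * (D j * D m) ≡ Row f m (suc N′) * (D (N′ + j) * D (m ∸ N′))
  Col*D*D≡Row*D*D j m N′ N′≤m = begin
      X * (D j * D m)                          ≡⟨ cong (λ t → X * (D j * t)) (sym (gbinom*D*D≡D m N′ N′≤m)) ⟩
      X * (D j * (Y * (D N′ * D (m ∸ N′))))    ≡⟨ rearrange X Y (D j) (D N′) (D (m ∸ N′)) ⟩
      Y * (X * (D j * D N′) * D (m ∸ N′))      ≡⟨ cong (λ t → Y * (t * D (m ∸ N′))) Col*D*D≡D ⟩
      Y * (D (N′ + j) * D (m ∸ N′))            ∎
    where
    rearrange : ∀ x y a b c → x * (a * (y * (b * c))) ≡ y * (x * (a * b) * c)
    rearrange = solve 5 (λ x y a b c → x :* (a :* (y :* (b :* c))) := y :* (x :* (a :* b) :* c)) refl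
    X Y : ℚ
    X = gbinom (toℚ f) (N′ + j) j
    Y = gbinom (toℚ f) m N′
    Col*D*D≡D : X * (D j * D N′) ≡ D (N′ + j)
    Col*D*D≡D = subst (λ i → X * (D j * D i) ≡ D (N′ + j)) (ℕ.m+n∸n≡m N′ j)
                      (gbinom*D*D≡D (N′ + j) j (ℕ.m≤n+m j N′))

  gbinom-Col≡gbinom-Row : ∀ n′ j k → k ≤ suc n′ →
    gbinom (Col f j) (suc n′) k ≡ gbinom (Row f (n′ + j)) (suc n′) k
  gbinom-Col≡gbinom-Row n′ j k k≤n =
    gbinom-palindromic-rescaling k k≤n u-palindrome (λ _ _ → refl)
      (λ { (suc N′) _ _ → gbinom-≢0 j toℚ≢0 (ℕ.m≤n+m j N′) })
      (λ { (suc N′) _ (s≤s N′≤n′) → gbinom-≢0 N′ toℚ≢0 (ℕ.≤-trans N′≤n′ (ℕ.m≤m+n n′ j)) })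
      (λ N _ _ → *-≢0 (D≢0 (N ∸ 1 + j)) (D≢0 (m ∸ (N ∸ 1))))
      (λ _ _ _ → *-≢0 (D≢0 j) (D≢0 m))
      (λ { (suc N′) _ (s≤s N′≤n′) → Col*D*D≡Row*D*D j m N′ (ℕ.≤-trans N′≤n′ (ℕ.m≤m+n n′ j)) })
    where
    m : ℕ
    m = n′ + j
    u : ℕ → ℚ
    u N = D (N ∸ 1 + j) * D (m ∸ (N ∸ 1))
    u-palindrome : Palindrome (suc n′) u
    u-palindrome i (s≤s i≤n′) = begin
        u (suc n′ ∸ i)                         ≡⟨ cong u (ℕ.+-∸-assoc 1 i≤n′) ⟩
        D (n′ ∸ i + j) * D (m ∸ (n′ ∸ i))      ≡⟨ cong₂ (λ a b → D a * D b) n′∸i+j≡m∸i m∸[n′∸i]≡i+j ⟩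
        D (m ∸ i) * D (i + j)                  ≡⟨ *-comm (D (m ∸ i)) (D (i + j)) ⟩
        u (suc i)                              ∎
      where
      n′∸i+j≡m∸i : n′ ∸ i + j ≡ m ∸ i
      n′∸i+j≡m∸i = sym (ℕ.+-∸-comm j i≤n′)
      m∸[n′∸i]≡i+j : m ∸ (n′ ∸ i) ≡ i + j
      m∸[n′∸i]≡i+j = trans (ℕ.+-∸-comm j (ℕ.m∸n≤m n′ i)) (cong (_+ j) (ℕ.m∸[m∸n]≡n i≤n′))

corollary2p4 : (f : ℕ → ℤ) → (∀ i → 1 ≤ i → f i ≢ + 0) → f 1 ≡ + 1 →
    ((∀ j → Binomid (Col f j)) ⇔ (∀ m → BinomidFin (ℕ.suc m) (Row f m)))
    × (BinomidAtEveryLevel f → ∀ m → BinomidFin (ℕ.suc m) (Row f m))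
corollary2p4 f f≢0 _ = mk⇔ cols⇒rows rows⇒cols , cols⇒rows
  where
  cols⇒rows : (∀ j → Binomid (Col f j)) → ∀ m → BinomidFin (suc m) (Row f m)
  cols⇒rows _    m zero     zero _ _          = isInteger-gbinom-zero (Row f m) 0
  cols⇒rows cols m (suc n′) k    k≤n (s≤s n′≤m) =
    subst (λ m′ → IsInteger (gbinom (Row f m′) (suc n′) k)) (ℕ.m+[n∸m]≡n n′≤m)
      (subst IsInteger (gbinom-Col≡gbinom-Row f f≢0 n′ (m ∸ n′) k k≤n) (cols (m ∸ n′) (suc n′) k k≤n))

  rows⇒cols : (∀ m → BinomidFin (suc m) (Row f m)) → ∀ j → Binomid (Col f j)
  rows⇒cols _    j zero     zero _ = isInteger-gbinom-zero (Col f j) 0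
  rows⇒cols rows j (suc n′) k    k≤n =
    subst IsInteger (sym (gbinom-Col≡gbinom-Row f f≢0 n′ j k k≤n))
      (rows (n′ + j) (suc n′) k k≤n (s≤s (ℕ.m≤m+n n′ j)))
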